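{- Let $s\ge 4$ and let $(G,k)$ be an instance of Vertex Triangle $s$-Club with $\ell=1$ in which every vertex of $G$ is contained in at least one triangle of $G$. If there is a vertex $v\in V(G)$ with $|N_{\lfloor s/2\rfloor-1}[v]|\ge k$, then $(G,k)$ is a yes-instance.
   Context: Vertex Triangle $s$-Club: given an undirected graph $G$ and integers $k,\ell\ge1$, decide whether $G$ contains a vertex set $S$ with $|S|\ge k$ such that $G[S]$ has diameter at most $s$ and every vertex of $S$ is contained in at least $\ell$ triangles of $G[S]$. For a vertex $v$ and integer $i\ge0$, $N_i[v]$ denotes the set of vertices at distance at most $i$ from $v$ in $G$. -}

module Defs where

open import Data.Nat using (ℕ; zero; suc; _+_; _<ᵇ_; _≤_)
open import Data.Bool using (Bool; true; false; _∧_; _∨_; if_then_else_)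
open import Data.Fin using (Fin; toℕ)
open import Data.Fin.Subset using (Subset; ⁅_⁆; ⊤; _∈_; ∣_∣)
open import Data.Vec using (tabulate; lookup)
open import Data.Product using (Σ; _×_)
open import Relation.Binary.PropositionalEquality using (_≡_)

record Graph (n : ℕ) : Set where
  field
    adj   : Fin n → Fin n → Bool
    sym   : ∀ u w → adj u w ≡ adj w u
    loopless : ∀ u → adj u u ≡ false
open Graph public

anyFin : ∀ {n} → (Fin n → Bool) → Bool
anyFin {zero}  f = false
anyFin {suc n} f = f Fin.zero ∨ anyFin (λ i → f (Fin.suc i))

countFin : ∀ {n} → (Fin n → Bool) → ℕ
countFin {zero}  f = 0
countFin {suc n} f = (if f Fin.zero then 1 else 0) + countFin (λ i → f (Fin.suc i))

-- ballIn G S i v : the set of vertices at distance at most i from v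
-- in the induced subgraph G[S] (for v ∈ S).
ballIn : ∀ {n} → Graph n → Subset n → ℕ → Fin n → Subset n
ballIn G S zero    v = ⁅ v ⁆
ballIn G S (suc i) v =
  tabulate λ w → lookup B w ∨
    (lookup S w ∧ anyFin (λ u → lookup B u ∧ lookup S u ∧ adj G u w))
  where B = ballIn G S i v

N[_]_at_ : ∀ {n} → Graph n → ℕ → Fin n → Subset n
N[ G ] i at v = ballIn G ⊤ i v

DiamAtMost : ∀ {n} → Graph n → Subset n → ℕ → Set
DiamAtMost G S s = ∀ u w → u ∈ S → w ∈ S → w ∈ ballIn G S s u

sumFin : ∀ {n} → (Fin n → ℕ) → ℕ
sumFin {zero}  f = 0
sumFin {suc n} f = f Fin.zero + sumFin (λ i → f (Fin.suc i))

-- number of triangles of G[S] containing u, i.e. unordered pairs {a,b}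
-- (counted once via toℕ a < toℕ b) with a, b ∈ S and u, a, b pairwise adjacent
triangles : ∀ {n} → Graph n → Subset n → Fin n → ℕ
triangles G S u = sumFin λ a → countFin λ b →
  (toℕ a <ᵇ toℕ b) ∧ lookup S a ∧ lookup S b ∧ adj G u a ∧ adj G u b ∧ adj G a b

YesInstance : ∀ {n} → Graph n → (s k ℓ : ℕ) → Set
YesInstance {n} G s k ℓ =
  Σ (Subset n) λ S → k ≤ ∣ S ∣ × DiamAtMost G S s × (∀ u → u ∈ S → ℓ ≤ triangles G S u)

-- Let B = N_r[v] with r = ⌊s/2⌋ − 1 and let H consist of B together with every vertex
-- lying in a triangle of G with a vertex of B. Then H ⊇ B, so |H| ≥ k; every vertex of H
-- lies in a triangle of G[H], since each triangle through a vertex of B lies wholly in H;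
-- and every vertex of H is within distance r + 1 of v in G[H], because the shortest
-- paths from v inside B survive in G[H]. Hence G[H] has diameter at most 2(r + 1) ≤ s.
module Submission where

open import Defs
open import Data.Bool using (Bool; true; false; _∧_; _∨_)
open import Data.Bool.Properties using (T-≡)
open import Data.Empty using (⊥-elim)
open import Data.Fin using (Fin; toℕ) renaming (zero to fzero; suc to fsuc)
open import Data.Fin.Properties using (toℕ-injective)
open import Data.Fin.Subset using (Subset; ⊤; ∣_∣; _∈_; _⊆_)
open import Data.Fin.Subset.Properties using (x∈⁅x⁆; x∈⁅y⁆⇒x≡y; p⊆q⇒∣p∣≤∣q∣)
open import Data.Nat
  using (ℕ; zero; suc; _+_; _∸_; _/_; _≤_; _<_; _<ᵇ_; _≤′_; ≤′-refl; ≤′-step; z≤n; s≤s)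
open import Data.Nat.DivMod using (m/n*n≤m; /-mono-≤)
open import Data.Nat.Properties
  using (+-identityʳ; +-suc; *-comm; ≤-trans; ≤-refl; m≤m+n; m≤n+m; m+[n∸m]≡n; <-cmp; <⇒<ᵇ; ≤⇒≤′)
open import Data.Product using (∃; ∃₂; _×_; _,_; proj₂)
open import Data.Sum using (_⊎_; inj₁; inj₂)
open import Data.Vec using (tabulate; lookup)
open import Data.Vec.Properties using (lookup∘tabulate; []=⇒lookup; lookup⇒[]=)
open import Function using (Equivalence)
open import Relation.Binary using (tri<; tri≈; tri>)
open import Relation.Binary.PropositionalEquality
  using (_≡_; _≢_; refl; trans; subst; cong) renaming (sym to ≡-sym)

∧≡true⁻ : ∀ {x y} → x ∧ y ≡ true → x ≡ true × y ≡ true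
∧≡true⁻ {true} y≡true = refl , y≡true

∧≡true⁺ : ∀ {x y} → x ≡ true → y ≡ true → x ∧ y ≡ true
∧≡true⁺ refl refl = refl

∨≡true⁻ : ∀ {x y} → x ∨ y ≡ true → x ≡ true ⊎ y ≡ true
∨≡true⁻ {true}  _      = inj₁ refl
∨≡true⁻ {false} y≡true = inj₂ y≡true

∨≡true⁺ˡ : ∀ {x y} → x ≡ true → x ∨ y ≡ true
∨≡true⁺ˡ refl = refl

∨≡true⁺ʳ : ∀ {x y} → y ≡ true → x ∨ y ≡ true
∨≡true⁺ʳ {true}  _      = refl
∨≡true⁺ʳ {false} y≡true = y≡true

module _ {n : ℕ} {f : Fin n → Bool} where

  ∈-tabulate⁺ : ∀ {x} → f x ≡ true → x ∈ tabulate f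
  ∈-tabulate⁺ {x} fx = lookup⇒[]= x _ (trans (lookup∘tabulate f x) fx)

  ∈-tabulate⁻ : ∀ {x} → x ∈ tabulate f → f x ≡ true
  ∈-tabulate⁻ {x} x∈ = trans (≡-sym (lookup∘tabulate f x)) ([]=⇒lookup x∈)

∈⇒lookup : ∀ {n} {S : Subset n} {x} → x ∈ S → lookup S x ≡ true
∈⇒lookup = []=⇒lookup

lookup⇒∈ : ∀ {n} {S : Subset n} {x} → lookup S x ≡ true → x ∈ S
lookup⇒∈ {S = S} {x} = lookup⇒[]= x S

anyFin⁻ : ∀ {n} (f : Fin n → Bool) → anyFin f ≡ true → ∃ λ i → f i ≡ true
anyFin⁻ {suc n} f any with f fzero in f0
... | true  = fzero , f0
... | false with anyFin⁻ (λ i → f (fsuc i)) any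
...   | i , fi = fsuc i , fi

anyFin⁺ : ∀ {n} (f : Fin n → Bool) i → f i ≡ true → anyFin f ≡ true
anyFin⁺ f fzero    fi = ∨≡true⁺ˡ fi
anyFin⁺ f (fsuc i) fi = ∨≡true⁺ʳ {f fzero} (anyFin⁺ (λ j → f (fsuc j)) i fi)

countFin-pos⁻ : ∀ {n} (f : Fin n → Bool) → 1 ≤ countFin f → ∃ λ i → f i ≡ true
countFin-pos⁻ {suc n} f pos with f fzero in f0
... | true  = fzero , f0
... | false with countFin-pos⁻ (λ i → f (fsuc i)) pos
...   | i , fi = fsuc i , fi

countFin-pos⁺ : ∀ {n} (f : Fin n → Bool) i → f i ≡ true → 1 ≤ countFin f
countFin-pos⁺ f fzero    fi rewrite fi = s≤s z≤n
countFin-pos⁺ f (fsuc i) fi =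
  ≤-trans (countFin-pos⁺ (λ j → f (fsuc j)) i fi) (m≤n+m _ _)

sumFin-pos⁻ : ∀ {n} (f : Fin n → ℕ) → 1 ≤ sumFin f → ∃ λ i → 1 ≤ f i
sumFin-pos⁻ {suc n} f pos with f fzero in f0
... | suc _ = fzero , subst (1 ≤_) (≡-sym f0) (s≤s z≤n)
... | zero with sumFin-pos⁻ (λ i → f (fsuc i)) pos
...   | i , fi = fsuc i , fi

sumFin-pos⁺ : ∀ {n} (f : Fin n → ℕ) i → 1 ≤ f i → 1 ≤ sumFin f
sumFin-pos⁺ f fzero    fi = ≤-trans fi (m≤m+n _ _)
sumFin-pos⁺ f (fsuc i) fi =
  ≤-trans (sumFin-pos⁺ (λ j → f (fsuc j)) i fi) (m≤n+m _ (f fzero))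

adj-sym : ∀ {n} (G : Graph n) {u w} → adj G u w ≡ true → adj G w u ≡ true
adj-sym G {u} {w} uw = trans (Graph.sym G w u) uw

module Balls {n : ℕ} (G : Graph n) (S : Subset n) where

  ball : ℕ → Fin n → Subset n
  ball = ballIn G S

  ball-zero : ∀ v → v ∈ ball 0 v
  ball-zero = x∈⁅x⁆

  ball-zero⁻ : ∀ {v w} → w ∈ ball 0 v → w ≡ v
  ball-zero⁻ {v} = x∈⁅y⁆⇒x≡y v

  ball-suc⁺ : ∀ i {v w} → w ∈ ball i v → w ∈ ball (suc i) v
  ball-suc⁺ i w∈ = ∈-tabulate⁺ (∨≡true⁺ˡ (∈⇒lookup w∈))

  ball-step : ∀ i {v u w} → u ∈ ball i v → u ∈ S → w ∈ S → adj G u w ≡ true →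
              w ∈ ball (suc i) v
  ball-step i {v} {u} {w} u∈ u∈S w∈S uw =
    ∈-tabulate⁺ (∨≡true⁺ʳ {lookup (ball i v) w} (∧≡true⁺ (∈⇒lookup w∈S)
      (anyFin⁺ _ u (∧≡true⁺ (∈⇒lookup u∈) (∧≡true⁺ (∈⇒lookup u∈S) uw)))))

  ball-suc⁻ : ∀ i {v w} → w ∈ ball (suc i) v →
              w ∈ ball i v ⊎ ∃ λ u → u ∈ ball i v × u ∈ S × w ∈ S × adj G u w ≡ true
  ball-suc⁻ i {v} {w} w∈ with ∨≡true⁻ (∈-tabulate⁻ w∈)
  ... | inj₁ w∈ball = inj₁ (lookup⇒∈ w∈ball)
  ... | inj₂ step with ∧≡true⁻ step
  ...   | w∈S , any with anyFin⁻ _ any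
  ...     | u , pu with ∧≡true⁻ pu
  ...       | u∈ , rest with ∧≡true⁻ rest
  ...         | u∈S , uw = inj₂ (u , lookup⇒∈ u∈ , lookup⇒∈ u∈S , lookup⇒∈ w∈S , uw)

  ball-mono : ∀ {i j v w} → i ≤ j → w ∈ ball i v → w ∈ ball j v
  ball-mono i≤j = go (≤⇒≤′ i≤j)
    where
    go : ∀ {i j v w} → i ≤′ j → w ∈ ball i v → w ∈ ball j v
    go ≤′-refl                 w∈ = w∈
    go (≤′-step {n = j} i≤′j) w∈ = ball-suc⁺ j (go i≤′j w∈)

  ball-centre : ∀ i v → v ∈ ball i v
  ball-centre i v = ball-mono {j = i} z≤n (ball-zero v)

  ball-trans : ∀ j i {x y z} → y ∈ ball j x → z ∈ ball i y → z ∈ ball (j + i) x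
  ball-trans j zero y∈ z∈ rewrite +-identityʳ j | ball-zero⁻ z∈ = y∈
  ball-trans j (suc i) y∈ z∈ rewrite +-suc j i with ball-suc⁻ i z∈
  ... | inj₁ z∈′ = ball-suc⁺ (j + i) (ball-trans j i y∈ z∈′)
  ... | inj₂ (u , u∈ , u∈S , z∈S , uz) = ball-step (j + i) (ball-trans j i y∈ u∈) u∈S z∈S uz

  ball-sym : ∀ i {u w} → u ∈ S → w ∈ S → w ∈ ball i u → u ∈ ball i w
  ball-sym zero u∈S w∈S w∈ rewrite ball-zero⁻ w∈ = ball-zero _
  ball-sym (suc i) u∈S w∈S w∈ with ball-suc⁻ i w∈
  ... | inj₁ w∈′ = ball-suc⁺ i (ball-sym i u∈S w∈S w∈′)
  ... | inj₂ (x , x∈ , x∈S , _ , xw) =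
    ball-trans 1 i (ball-step 0 (ball-zero _) w∈S x∈S (adj-sym G xw))
                   (ball-sym i u∈S x∈S x∈)

  radius⇒DiamAtMost : ∀ {r v} → v ∈ S → (∀ {w} → w ∈ S → w ∈ ball r v) →
                      DiamAtMost G S (r + r)
  radius⇒DiamAtMost {r} v∈S within u w u∈S w∈S =
    ball-trans r r (ball-sym r v∈S u∈S (within u∈S)) (within w∈S)

  DiamAtMost-mono : ∀ {d e} → d ≤ e → DiamAtMost G S d → DiamAtMost G S e
  DiamAtMost-mono d≤e diam u w u∈S w∈S = ball-mono d≤e (diam u w u∈S w∈S)

open Balls using (ball-suc⁺; ball-step; ball-suc⁻; ball-centre)

-- A ball of G is closed under predecessors on shortest paths from its centre.
ball⊤⊆ballIn : ∀ {n} (G : Graph n) {S : Subset n} i v →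
               ballIn G ⊤ i v ⊆ S → ballIn G ⊤ i v ⊆ ballIn G S i v
ball⊤⊆ballIn G zero    v _      w∈ = w∈
ball⊤⊆ballIn G {S} (suc i) v ball⊆S {w} w∈ = from-smaller-ball (ball-suc⁻ G ⊤ i w∈)
  where
  smaller⊆S : ballIn G ⊤ i v ⊆ S
  smaller⊆S x∈ = ball⊆S (ball-suc⁺ G ⊤ i x∈)

  from-smaller-ball : w ∈ ballIn G ⊤ i v ⊎
                      (∃ λ u → u ∈ ballIn G ⊤ i v × u ∈ ⊤ × w ∈ ⊤ × adj G u w ≡ true) →
                      w ∈ ballIn G S (suc i) v
  from-smaller-ball (inj₁ w∈′) = ball-suc⁺ G S i (ball⊤⊆ballIn G i v smaller⊆S w∈′)
  from-smaller-ball (inj₂ (u , u∈ , _ , _ , uw)) =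
    ball-step G S i (ball⊤⊆ballIn G i v smaller⊆S u∈) (smaller⊆S u∈) (ball⊆S w∈) uw

triangle? : ∀ {n} → Graph n → Fin n → Fin n → Fin n → Bool
triangle? G u a b = adj G u a ∧ adj G u b ∧ adj G a b

Triangle : ∀ {n} → Graph n → Fin n → Fin n → Fin n → Set
Triangle G u a b = adj G u a ≡ true × adj G u b ≡ true × adj G a b ≡ true

module Triangles {n : ℕ} (G : Graph n) where

  triangle?⁻ : ∀ {u a b} → triangle? G u a b ≡ true → Triangle G u a b
  triangle?⁻ t with ∧≡true⁻ t
  ... | ua , rest with ∧≡true⁻ rest
  ...   | ub , ab = ua , ub , ab

  triangle?⁺ : ∀ {u a b} → Triangle G u a b → triangle? G u a b ≡ true
  triangle?⁺ (ua , ub , ab) = ∧≡true⁺ ua (∧≡true⁺ ub ab)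

  Triangle-swapˡ : ∀ {u a b} → Triangle G u a b → Triangle G a u b
  Triangle-swapˡ (ua , ub , ab) = adj-sym G ua , ab , ub

  Triangle-swapʳ : ∀ {u a b} → Triangle G u a b → Triangle G u b a
  Triangle-swapʳ (ua , ub , ab) = ub , ua , adj-sym G ab

  Triangle⇒distinct : ∀ {u a b} → Triangle G u a b → a ≢ b
  Triangle⇒distinct {a = a} (_ , _ , aa) refl with trans (≡-sym aa) (loopless G a)
  ... | ()

  triangles-pos⁻ : ∀ {S w} → 1 ≤ triangles G S w →
                   ∃₂ λ a b → a ∈ S × b ∈ S × Triangle G w a b
  triangles-pos⁻ pos with sumFin-pos⁻ _ pos
  ... | a , a-pos with countFin-pos⁻ _ a-pos
  ...   | b , entry with ∧≡true⁻ (proj₂ (∧≡true⁻ {toℕ a <ᵇ toℕ b} entry))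
  ...     | a∈S , rest with ∧≡true⁻ rest
  ...       | b∈S , t = a , b , lookup⇒∈ a∈S , lookup⇒∈ b∈S , triangle?⁻ t

  triangles-pos⁺-< : ∀ {S w a b} → toℕ a < toℕ b → a ∈ S → b ∈ S → Triangle G w a b →
                     1 ≤ triangles G S w
  triangles-pos⁺-< {a = a} {b} a<b a∈S b∈S t =
    sumFin-pos⁺ _ a (countFin-pos⁺ _ b
      (∧≡true⁺ (Equivalence.to T-≡ (<⇒<ᵇ a<b))
        (∧≡true⁺ (∈⇒lookup a∈S) (∧≡true⁺ (∈⇒lookup b∈S) (triangle?⁺ t)))))

  triangles-pos⁺ : ∀ {S w a b} → a ∈ S → b ∈ S → Triangle G w a b → 1 ≤ triangles G S w
  triangles-pos⁺ {a = a} {b} a∈S b∈S t with <-cmp (toℕ a) (toℕ b)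
  ... | tri< a<b _ _ = triangles-pos⁺-< a<b a∈S b∈S t
  ... | tri> _ _ b<a = triangles-pos⁺-< b<a b∈S a∈S (Triangle-swapʳ t)
  ... | tri≈ _ a≡b _ = ⊥-elim (Triangle⇒distinct t (toℕ-injective a≡b))

triangleHull : ∀ {n} → Graph n → Subset n → Subset n
triangleHull G B = tabulate λ w →
  lookup B w ∨ anyFin λ u → lookup B u ∧ anyFin λ b → triangle? G u w b

module TriangleHull {n : ℕ} (G : Graph n) (B : Subset n) where
  open Triangles G

  H : Subset n
  H = triangleHull G B

  ⊆-triangleHull : B ⊆ H
  ⊆-triangleHull w∈B = ∈-tabulate⁺ (∨≡true⁺ˡ (∈⇒lookup w∈B))

  triangleHull⁺ : ∀ {u w b} → u ∈ B → Triangle G u w b → w ∈ H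
  triangleHull⁺ {u} {w} {b} u∈B t =
    ∈-tabulate⁺ (∨≡true⁺ʳ {lookup B w}
      (anyFin⁺ _ u (∧≡true⁺ (∈⇒lookup u∈B) (anyFin⁺ _ b (triangle?⁺ t)))))

  triangleHull⁻ : ∀ {w} → w ∈ H → w ∈ B ⊎ ∃₂ λ u b → u ∈ B × Triangle G u w b
  triangleHull⁻ {w} w∈H with ∨≡true⁻ (∈-tabulate⁻ w∈H)
  ... | inj₁ w∈B = inj₁ (lookup⇒∈ w∈B)
  ... | inj₂ any with anyFin⁻ _ any
  ...   | u , pu with ∧≡true⁻ pu
  ...     | u∈B , any′ with anyFin⁻ _ any′
  ...       | b , t = inj₂ (u , b , lookup⇒∈ u∈B , triangle?⁻ t)

  triangleHull-triangles : (∀ u → 1 ≤ triangles G ⊤ u) → ∀ {w} → w ∈ H → 1 ≤ triangles G H w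
  triangleHull-triangles inTriangle {w} w∈H with triangleHull⁻ w∈H
  ... | inj₂ (_ , _ , u∈B , t) =
    triangles-pos⁺ (⊆-triangleHull u∈B) (triangleHull⁺ u∈B (Triangle-swapʳ t)) (Triangle-swapˡ t)
  ... | inj₁ w∈B with triangles-pos⁻ {S = ⊤} (inTriangle w)
  ...   | _ , _ , _ , _ , t =
    triangles-pos⁺ (triangleHull⁺ w∈B t) (triangleHull⁺ w∈B (Triangle-swapʳ t)) t

  triangleHull-radius : ∀ {r v} → B ⊆ ballIn G H r v → H ⊆ ballIn G H (suc r) v
  triangleHull-radius {r} B⊆ball w∈H with triangleHull⁻ w∈H
  ... | inj₁ w∈B = ball-suc⁺ G H r (B⊆ball w∈B)
  ... | inj₂ (_ , _ , u∈B , uw , _) = ball-step G H r (B⊆ball u∈B) (⊆-triangleHull u∈B) w∈H uw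

-- 2 ≤ s already suffices; this is all that the hypothesis 4 ≤ s of the theorem is used for.
radius-bound : ∀ s → 2 ≤ s → suc (s / 2 ∸ 1) + suc (s / 2 ∸ 1) ≤ s
radius-bound s 2≤s = subst (λ h → h + h ≤ s) (≡-sym (m+[n∸m]≡n 1≤s/2)) s/2+s/2≤s
  where
  1≤s/2 : 1 ≤ s / 2
  1≤s/2 = /-mono-≤ 2≤s (≤-refl {2})
  s/2+s/2≤s : s / 2 + s / 2 ≤ s
  s/2+s/2≤s = subst (_≤ s) (trans (*-comm (s / 2) 2) (cong (s / 2 +_) (+-identityʳ (s / 2))))
                    (m/n*n≤m s 2)

lemma1 : ∀ {n} (G : Graph n) (s k : ℕ) → 4 ≤ s → 1 ≤ k →
         (∀ u → 1 ≤ triangles G ⊤ u) →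
         (v : Fin n) → k ≤ ∣ N[ G ] (s / 2 ∸ 1) at v ∣ →
         YesInstance G s k 1
lemma1 G s k 4≤s _ inTriangle v k≤∣N∣ = H , k≤∣H∣ , diam , λ _ → triangleHull-triangles inTriangle
  where
  r : ℕ
  r = s / 2 ∸ 1
  open TriangleHull G (N[ G ] r at v)
  open Balls G H using (radius⇒DiamAtMost; DiamAtMost-mono)

  k≤∣H∣ : k ≤ ∣ H ∣
  k≤∣H∣ = ≤-trans k≤∣N∣ (p⊆q⇒∣p∣≤∣q∣ ⊆-triangleHull)

  H⊆ball : H ⊆ ballIn G H (suc r) v
  H⊆ball = triangleHull-radius {r} {v} (ball⊤⊆ballIn G r v ⊆-triangleHull)

  diam : DiamAtMost G H s
  diam = DiamAtMost-mono (radius-bound s (≤-trans (s≤s (s≤s z≤n)) 4≤s))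
           (radius⇒DiamAtMost {suc r} (⊆-triangleHull (ball-centre G ⊤ r v)) H⊆ball)
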